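{- Let $P$ be a dynamic path (as in the context) and let $x$ be a sink location. Suppose there is a vertex $x_j$ with $x_j<x$ (so that edge $e_{j+1}$ is traversed by people evacuating from $x_j$ to $x$) and $j\ge 1$, such that $c_j>c_{j+1}$. Let $P'$ be the dynamic path identical to $P$ except that the capacity of $e_j$ is changed to $c_{j+1}$. Then $\Theta_L(P',x)=\Theta_L(P,x)$.
   Context: A dynamic path $P$ consists of real points (vertices) $x_0<\dots<x_n$, edges $e_i=(x_{i-1},x_i)$ for $1\le i\le n$, a constant $\tau>0$ (time to travel unit distance) with every $|x_i-x_j|\tau$ an integer, nonnegative integer weights $w_i$ (people at $x_i$) and positive integer capacities $c_i$ of $e_i$. Discrete evacuation model with sink $x\in[x_0,x_n]$: everyone moves toward $x$; time is discrete; at each vertex people wait in a FIFO queue to enter the next edge toward $x$; at each integer time step at most $c_i$ people (a wave) may enter $e_i$, entering as soon as capacity and the queue permit; a wave covers distance $d$ in time $d\tau$ and on reaching the far vertex of an edge its members join that vertex's queue. $\Theta_L(P,x)$ is the time at which all people starting on vertices strictly left of $x$ have reached $x$.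
   Formalization: The sink location x ranges only over points of $[x_0,x_n]$ whose distance from the nearest vertex strictly to their left, multiplied by τ, is rational. -}

module Defs where

open import Data.Nat using (ℕ; zero; suc; _+_; _∸_; _⊓_; _<_; _≤_; _≤ᵇ_)
open import Data.Bool using (if_then_else_)
open import Data.Integer using (+_)
open import Data.Rational using (ℚ; _/_; 0ℚ) renaming (_+_ to _+ℚ_)
open import Data.Product using (Σ; _×_)
open import Data.Sum using (_⊎_)
open import Relation.Binary.PropositionalEquality using (_≡_)

-- All data are indexed by ℕ
-- following the paper's numbering; values outside the meaningful range are
-- irrelevant (never used by the dynamics below).
--   len i    = (x_i - x_{i-1}) τ , travel time of edge e_i   (1 ≤ i ≤ n), a positive integer
--   weight i = w_i, people initially at x_i                  (0 ≤ i ≤ n)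
--   cap i    = c_i, capacity of edge e_i                     (1 ≤ i ≤ n), positive
record DynPath : Set where
  field
    n       : ℕ
    len     : ℕ → ℕ
    len-pos : ∀ i → i < n → 0 < len (suc i)
    weight  : ℕ → ℕ
    cap     : ℕ → ℕ
    cap-pos : ∀ i → i < n → 0 < cap (suc i)

open DynPath public

toℚ : ℕ → ℚ
toℚ k = + k / 1

-- Discrete leftward-part dynamics (everyone at x_0..x_m moves right toward the sink).
-- Given weights w, capacities c, lengths l:
--   qB k s  = queue at vertex x_k at integer time s (after arrivals at time s, before departures)
--   dep k s = number of people entering edge e_{k+1} (out of x_k, toward the sink) at time s
--   arr k s = number of people arriving at x_k (via e_k) at time s
module Dynamics (w c l : ℕ → ℕ) where
  mutual
    qB : ℕ → ℕ → ℕ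
    qB k zero    = w k + arr k zero
    qB k (suc s) = (qB k s ∸ dep k s) + arr k (suc s)

    dep : ℕ → ℕ → ℕ
    dep k s = c (suc k) ⊓ qB k s

    arr : ℕ → ℕ → ℕ
    arr zero    s = 0
    arr (suc k) s = if l (suc k) ≤ᵇ s then dep k (s ∸ l (suc k)) else 0

  cumDep : ℕ → ℕ → ℕ
  cumDep k zero    = dep k zero
  cumDep k (suc s) = cumDep k s + dep k (suc s)

sumTo : (ℕ → ℕ) → ℕ → ℕ
sumTo f zero    = f zero
sumTo f (suc m) = sumTo f m + f (suc m)

-- Sink x with x_m < x ≤ x_{m+1}, and d = (x - x_m) τ ∈ (0, len (m+1)].
-- The people strictly left of x are those initially at x_0..x_m; they leave x_m
-- through e_{m+1} and reach x exactly d time units later.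
-- IsΘL P m d θ : θ is Θ_L(P, x), the time at which all of them have reached x.
IsΘL : DynPath → ℕ → ℚ → ℚ → Set
IsΘL P m d θ =
  (W ≡ 0 × θ ≡ 0ℚ)
  ⊎ (0 < W × Σ ℕ (λ s → cumDep m s ≡ W
                         × (∀ s′ → s′ < s → cumDep m s′ < W)
                         × θ ≡ toℚ s +ℚ d))
  where
    open Dynamics (weight P) (cap P) (len P)
    W : ℕ
    W = sumTo (weight P) m

-- Write D(s) for the number of people that have left a vertex by time s,
-- I(s) for the number that have reached it and c for the capacity of its
-- outgoing edge; then D(s) = min (D(s-1) + c, I(s)).  Lowering c_j to
-- c_{j+1} slows the outflow D of x_{j-1}, but only to the benefit of x_j:
-- whenever the modified path lags behind the original one at x_{j-1}, that
-- vertex is sending full waves of c_{j+1} people, so at the matching time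
-- x_j has at least c_{j+1} people queued in both paths and releases a full
-- wave of c_{j+1} in both.  Hence the outflow of x_j, and with it everything
-- downstream up to the sink, is unchanged.
module Submission where

open import Defs
open import Data.Nat using (ℕ; zero; suc; _+_; _∸_; _⊓_; _<_; _≤_; _≤ᵇ_; z≤n; s≤s; _≟_; _≤?_)
open import Data.Nat.Properties
open import Data.Nat.Induction using (<-rec)
open import Data.Bool using (true; false; if_then_else_)
open import Data.Rational using (ℚ; 0ℚ) renaming (_<_ to _<ℚ_; _≤_ to _≤ℚ_; _+_ to _+ℚ_)
open import Data.Product using (Σ; ∃; _×_; _,_)
open import Data.Sum using (_⊎_; inj₁; inj₂)
open import Relation.Nullary using (¬_; Dec; yes; no; contradiction)
open import Relation.Binary.PropositionalEquality using (_≡_; _≢_; refl; sym; trans; cong; cong₂; subst; subst₂)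
open Relation.Binary.PropositionalEquality using (module ≡-Reasoning)

sumTo-cong : ∀ {f g} → (∀ i → f i ≡ g i) → ∀ m → sumTo f m ≡ sumTo g m
sumTo-cong f≗g zero    = f≗g zero
sumTo-cong f≗g (suc m) = cong₂ _+_ (sumTo-cong f≗g m) (f≗g (suc m))

sumTo-zero : ∀ m → sumTo (λ _ → 0) m ≡ 0
sumTo-zero zero    = refl
sumTo-zero (suc m) = cong (_+ 0) (sumTo-zero m)

sumTo-suc : ∀ f m → sumTo f (suc m) ≡ f 0 + sumTo (λ i → f (suc i)) m
sumTo-suc f zero    = refl
sumTo-suc f (suc m) = trans (cong (_+ f (suc (suc m))) (sumTo-suc f m)) (+-assoc (f 0) _ _)

-- Arrivals at x_{k+1} are definitionally the departures from x_k delayed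
-- by the travel time: arr (suc k) = delay (l (suc k)) (dep k).
delay : ℕ → (ℕ → ℕ) → ℕ → ℕ
delay L f s = if L ≤ᵇ s then f (s ∸ L) else 0

delay-suc : ∀ L f s → delay (suc L) f (suc s) ≡ delay L f s
delay-suc zero    f s = refl
delay-suc (suc L) f s = refl

delay-cong : ∀ L {f g} → (∀ t → f t ≡ g t) → ∀ s → delay L f s ≡ delay L g s
delay-cong L f≗g s with L ≤ᵇ s
... | true  = f≗g (s ∸ L)
... | false = refl

delay-≤ : ∀ {L s} f → L ≤ s → delay L f s ≡ f (s ∸ L)
delay-≤ {L} {s} f L≤s with L ≤ᵇ s | ≤⇒≤ᵇ L≤s
... | true | _ = refl

delay-≰ : ∀ {L s} f → ¬ L ≤ s → delay L f s ≡ 0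
delay-≰ {L} {s} f L≰s with L ≤ᵇ s | ≤ᵇ⇒≤ L s
... | true  | L≤s = contradiction (L≤s _) L≰s
... | false | _   = refl

delay-bounded : ∀ L {f B} → (∀ t → f t ≤ B) → ∀ s → delay L f s ≤ B
delay-bounded L f≤B s with L ≤ᵇ s
... | true  = f≤B (s ∸ L)
... | false = z≤n

sumTo-delay : ∀ L f s → sumTo (delay L f) s ≡ delay L (sumTo f) s
sumTo-delay zero    f zero    = refl
sumTo-delay zero    f (suc s) = cong (_+ f (suc s)) (sumTo-delay zero f s)
sumTo-delay (suc L) f zero    = refl
sumTo-delay (suc L) f (suc s) = begin
  sumTo (delay (suc L) f) (suc s)                  ≡⟨ sumTo-suc (delay (suc L) f) s ⟩
  sumTo (λ t → delay (suc L) f (suc t)) s          ≡⟨ sumTo-cong (delay-suc L f) s ⟩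
  sumTo (delay L f) s                              ≡⟨ sumTo-delay L f s ⟩
  delay L (sumTo f) s                              ≡⟨ delay-suc L (sumTo f) s ⟨
  delay (suc L) (sumTo f) (suc s)                  ∎
  where open ≡-Reasoning

Least : (ℕ → Set) → Set
Least P = Σ ℕ λ s → P s × (∀ s′ → s′ < s → ¬ P s′)

leastWitness : ∀ {P} → (∀ n → Dec (P n)) → ∀ T → P T → Least P
leastWitness {P} P? = <-rec (λ T → P T → Least P) search
  where
  search : ∀ T → (∀ {S} → S < T → P S → Least P) → P T → Least P
  search T earlier PT with anyUpTo? P? T
  ... | yes (S , S<T , PS) = earlier S<T PS
  ... | no none            = T , PT , λ s′ s′<T Ps′ → none (s′ , s′<T , Ps′)

-- IsΘL P m d θ unfolds to IsCompletionTime (sumTo (weight P) m) (cumDep m) d θ.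
IsCompletionTime : ℕ → (ℕ → ℕ) → ℚ → ℚ → Set
IsCompletionTime W D d θ =
  (W ≡ 0 × θ ≡ 0ℚ)
  ⊎ (0 < W × Σ ℕ (λ s → D s ≡ W × (∀ s′ → s′ < s → D s′ < W) × θ ≡ toℚ s +ℚ d))

completionTime-exists : ∀ {W D} d → (∀ s → D s ≤ W) → ∀ T → D T ≡ W → Σ ℚ (IsCompletionTime W D d)
completionTime-exists {zero}    d _ _ _ = 0ℚ , inj₁ (refl , refl)
completionTime-exists {suc W} {D} d D≤W T DT≡W with leastWitness (λ s → D s ≟ suc W) T DT≡W
... | s , Ds≡W , earlier =
  toℚ s +ℚ d , inj₂ (s≤s z≤n , s , Ds≡W , (λ s′ s′<s → ≤∧≢⇒< (D≤W s′) (earlier s′ s′<s)) , refl)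

completionTime-cong : ∀ {W W′ D D′ d θ} → W ≡ W′ → (∀ s → D s ≡ D′ s)
                    → IsCompletionTime W D d θ → IsCompletionTime W′ D′ d θ
completionTime-cong refl _ (inj₁ empty) = inj₁ empty
completionTime-cong refl D≗D′ (inj₂ (W>0 , s , Ds≡W , earlier , θ≡)) =
  inj₂ (W>0 , s , trans (sym (D≗D′ s)) Ds≡W , (λ s′ s′<s → subst (_< _) (D≗D′ s′) (earlier s′ s′<s)) , θ≡)

module Flow (w c l : ℕ → ℕ) where
  open Dynamics w c l public

  inflow : ℕ → ℕ → ℕ
  inflow k s = w k + sumTo (arr k) s

  depBefore : ℕ → ℕ → ℕ
  depBefore k zero    = 0
  depBefore k (suc s) = cumDep k s

  cumDep≡depBefore+dep : ∀ k s → cumDep k s ≡ depBefore k s + dep k s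
  cumDep≡depBefore+dep k zero    = refl
  cumDep≡depBefore+dep k (suc s) = refl

  cumDep≡sumTo-dep : ∀ k s → cumDep k s ≡ sumTo (dep k) s
  cumDep≡sumTo-dep k zero    = refl
  cumDep≡sumTo-dep k (suc s) = cong (_+ dep k (suc s)) (cumDep≡sumTo-dep k s)

  arr≤qB : ∀ k s → arr k s ≤ qB k s
  arr≤qB k zero    = m≤n+m (arr k zero) (w k)
  arr≤qB k (suc s) = m≤n+m (arr k (suc s)) _

  depBefore+qB≡inflow : ∀ k s → depBefore k s + qB k s ≡ inflow k s
  depBefore+qB≡inflow k zero    = refl
  depBefore+qB≡inflow k (suc s) = begin
    cumDep k s + (qB k s ∸ dep k s + arr k (suc s))
      ≡⟨ +-assoc (cumDep k s) _ _ ⟨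
    cumDep k s + (qB k s ∸ dep k s) + arr k (suc s)
      ≡⟨ cong (λ x → x + (qB k s ∸ dep k s) + arr k (suc s)) (cumDep≡depBefore+dep k s) ⟩
    depBefore k s + dep k s + (qB k s ∸ dep k s) + arr k (suc s)
      ≡⟨ cong (_+ arr k (suc s)) (+-assoc (depBefore k s) _ _) ⟩
    depBefore k s + (dep k s + (qB k s ∸ dep k s)) + arr k (suc s)
      ≡⟨ cong (λ x → depBefore k s + x + arr k (suc s)) (m+[n∸m]≡n (m⊓n≤n (c (suc k)) (qB k s))) ⟩
    depBefore k s + qB k s + arr k (suc s)
      ≡⟨ cong (_+ arr k (suc s)) (depBefore+qB≡inflow k s) ⟩
    w k + sumTo (arr k) s + arr k (suc s)
      ≡⟨ +-assoc (w k) _ _ ⟩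
    inflow k (suc s) ∎
    where open ≡-Reasoning

  cumDep-recurrence : ∀ k s → cumDep k s ≡ (depBefore k s + c (suc k)) ⊓ inflow k s
  cumDep-recurrence k s = begin
    cumDep k s                                              ≡⟨ cumDep≡depBefore+dep k s ⟩
    depBefore k s + c (suc k) ⊓ qB k s                      ≡⟨ +-distribˡ-⊓ (depBefore k s) _ _ ⟩
    (depBefore k s + c (suc k)) ⊓ (depBefore k s + qB k s)  ≡⟨ cong ((depBefore k s + c (suc k)) ⊓_) (depBefore+qB≡inflow k s) ⟩
    (depBefore k s + c (suc k)) ⊓ inflow k s                ∎
    where open ≡-Reasoning

  cumDep≤inflow : ∀ k s → cumDep k s ≤ inflow k s
  cumDep≤inflow k s = subst (_≤ inflow k s) (sym (cumDep-recurrence k s)) (m⊓n≤n _ _)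

  depBefore+arr≤inflow : ∀ k s → depBefore k s + arr k s ≤ inflow k s
  depBefore+arr≤inflow k s =
    subst (depBefore k s + arr k s ≤_) (depBefore+qB≡inflow k s) (+-monoʳ-≤ (depBefore k s) (arr≤qB k s))

  cumDep-mono : ∀ k {s t} → s ≤ t → cumDep k s ≤ cumDep k t
  cumDep-mono k {t = zero}  z≤n  = ≤-refl
  cumDep-mono k {t = suc t} s≤1+t with m≤n⇒m<n∨m≡n s≤1+t
  ... | inj₂ refl      = ≤-refl
  ... | inj₁ (s≤s s≤t) = ≤-trans (cumDep-mono k s≤t) (m≤m+n (cumDep k t) _)

  inflow-zero : ∀ s → inflow 0 s ≡ w 0
  inflow-zero s = trans (cong (w 0 +_) (sumTo-zero s)) (+-identityʳ (w 0))

  inflow-suc : ∀ k s → inflow (suc k) s ≡ w (suc k) + delay (l (suc k)) (cumDep k) s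
  inflow-suc k s = cong (w (suc k) +_)
    (trans (sumTo-delay (l (suc k)) (dep k) s)
           (delay-cong (l (suc k)) (λ t → sym (cumDep≡sumTo-dep k t)) s))

  inflow≤total : ∀ k s → inflow k s ≤ sumTo w k
  cumDep≤total : ∀ k s → cumDep k s ≤ sumTo w k
  inflow≤total zero    s = ≤-reflexive (inflow-zero s)
  inflow≤total (suc k) s = begin
    inflow (suc k) s                             ≡⟨ inflow-suc k s ⟩
    w (suc k) + delay (l (suc k)) (cumDep k) s   ≤⟨ +-monoʳ-≤ (w (suc k)) (delay-bounded (l (suc k)) (cumDep≤total k) s) ⟩
    w (suc k) + sumTo w k                        ≡⟨ +-comm (w (suc k)) _ ⟩
    sumTo w (suc k)                              ∎
    where open ≤-Reasoning
  cumDep≤total k s = ≤-trans (cumDep≤inflow k s) (inflow≤total k s)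

  cumDep-catches-up : ∀ k → 0 < c (suc k) → ∀ T S → (∀ s → T ≤ s → inflow k s ≡ S)
                    → ∀ r → S ⊓ r ≤ cumDep k (T + r)
  cumDep-catches-up k _ T S _ zero = ≤-trans (m⊓n≤n S 0) z≤n
  cumDep-catches-up k c>0 T S frozen (suc r)
    rewrite +-suc T r
          | cumDep-recurrence k (suc (T + r))
          | frozen (suc (T + r)) (m≤n⇒m≤1+n (m≤m+n T r))
          = ⊓-glb behind (m⊓n≤m S (suc r))
    where
    open ≤-Reasoning
    behind : S ⊓ suc r ≤ cumDep k (T + r) + c (suc k)
    behind = begin
      S ⊓ suc r                       ≤⟨ ⊓-monoˡ-≤ (suc r) (n≤1+n S) ⟩
      suc (S ⊓ r)                     ≤⟨ s≤s (cumDep-catches-up k c>0 T S frozen r) ⟩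
      suc (cumDep k (T + r))          ≡⟨ +-comm 1 _ ⟩
      cumDep k (T + r) + 1            ≤⟨ +-monoʳ-≤ (cumDep k (T + r)) c>0 ⟩
      cumDep k (T + r) + c (suc k)    ∎

  cumDep-settles : ∀ k → 0 < c (suc k) → ∀ T S → (∀ s → T ≤ s → inflow k s ≡ S)
                 → ∀ s → T + S ≤ s → cumDep k s ≡ S
  cumDep-settles k c>0 T S frozen s T+S≤s = ≤-antisym
    (subst (cumDep k s ≤_) (frozen s (≤-trans (m≤m+n T S) T+S≤s)) (cumDep≤inflow k s))
    (subst (_≤ cumDep k s) (⊓-idem S)
      (≤-trans (cumDep-catches-up k c>0 T S frozen S) (cumDep-mono k T+S≤s)))

  cumDep-eventually-total : ∀ k → (∀ k′ → k′ ≤ k → 0 < c (suc k′))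
                          → ∃ λ T → ∀ s → T ≤ s → cumDep k s ≡ sumTo w k
  cumDep-eventually-total zero c>0 =
    w 0 , cumDep-settles 0 (c>0 0 z≤n) 0 (w 0) (λ s _ → inflow-zero s)
  cumDep-eventually-total (suc k) c>0
    with cumDep-eventually-total k (λ k′ k′≤k → c>0 k′ (m≤n⇒m≤1+n k′≤k))
  ... | T , settled =
    T + L + sumTo w (suc k) , cumDep-settles (suc k) (c>0 (suc k) ≤-refl) (T + L) (sumTo w (suc k)) frozen
    where
    open ≡-Reasoning
    L : ℕ
    L = l (suc k)
    frozen : ∀ s → T + L ≤ s → inflow (suc k) s ≡ sumTo w (suc k)
    frozen s T+L≤s = begin
      inflow (suc k) s             ≡⟨ inflow-suc k s ⟩
      w (suc k) + delay L (cumDep k) s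
        ≡⟨ cong (w (suc k) +_) (delay-≤ (cumDep k) (≤-trans (m≤n+m L T) T+L≤s)) ⟩
      w (suc k) + cumDep k (s ∸ L)
        ≡⟨ cong (w (suc k) +_) (settled (s ∸ L) (subst (_≤ s ∸ L) (m+n∸n≡m T L) (∸-monoˡ-≤ L T+L≤s))) ⟩
      w (suc k) + sumTo w k        ≡⟨ +-comm (w (suc k)) _ ⟩
      sumTo w (suc k)              ∎

ΘL-exists : (P : DynPath) (m : ℕ) (d : ℚ) → m < n P → Σ ℚ (IsΘL P m d)
ΘL-exists P m d m<n =
  let T , settled = cumDep-eventually-total m (λ k k≤m → cap-pos P k (≤-<-trans k≤m m<n))
  in completionTime-exists d (cumDep≤total m) T (settled T ≤-refl)
  where open Flow (weight P) (cap P) (len P)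

module Agreement (w c l w′ c′ l′ : ℕ → ℕ) (w≗w′ : ∀ k → w k ≡ w′ k) (l≗l′ : ∀ k → l k ≡ l′ k) where
  module A = Flow w c l
  module B = Flow w′ c′ l′

  dep-agree : ∀ k → c (suc k) ≡ c′ (suc k) → (∀ s → A.arr k s ≡ B.arr k s) → ∀ s → A.dep k s ≡ B.dep k s
  dep-agree k c≡c′ arr≡ s = cong₂ _⊓_ c≡c′ (qB-agree s)
    where
    qB-agree : ∀ s → A.qB k s ≡ B.qB k s
    qB-agree zero    = cong₂ _+_ (w≗w′ k) (arr≡ zero)
    qB-agree (suc s) = cong₂ _+_ (cong₂ _∸_ (qB-agree s) (cong₂ _⊓_ c≡c′ (qB-agree s))) (arr≡ (suc s))

  arr-agree-suc : ∀ k → (∀ s → A.dep k s ≡ B.dep k s) → ∀ s → A.arr (suc k) s ≡ B.arr (suc k) s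
  arr-agree-suc k dep≡ s =
    trans (delay-cong (l (suc k)) dep≡ s) (cong (λ L → delay L (B.dep k) s) (l≗l′ (suc k)))

  arr-agree-upTo : ∀ i → (∀ k → k < i → c (suc k) ≡ c′ (suc k)) → ∀ s → A.arr i s ≡ B.arr i s
  arr-agree-upTo zero    _ _ = refl
  arr-agree-upTo (suc i) c≡c′ =
    arr-agree-suc i (dep-agree i (c≡c′ i ≤-refl) (arr-agree-upTo i (λ k k<i → c≡c′ k (m<n⇒m<1+n k<i))))

  dep-agree-beyond : ∀ j → (∀ s → A.dep j s ≡ B.dep j s) → (∀ k → j < k → c (suc k) ≡ c′ (suc k))
                   → ∀ k → j ≤ k → ∀ s → A.dep k s ≡ B.dep k s
  dep-agree-beyond j dep≡ c≡c′ zero    z≤n = dep≡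
  dep-agree-beyond j dep≡ c≡c′ (suc k) j≤1+k with m≤n⇒m<n∨m≡n j≤1+k
  ... | inj₂ refl      = dep≡
  ... | inj₁ (s≤s j≤k) =
    dep-agree (suc k) (c≡c′ (suc k) (s≤s j≤k)) (arr-agree-suc k (dep-agree-beyond j dep≡ c≡c′ k j≤k))

  dep-agree-of-cumDep : ∀ k → (∀ s → A.cumDep k s ≡ B.cumDep k s) → ∀ s → A.dep k s ≡ B.dep k s
  dep-agree-of-cumDep k cum≡ zero    = cum≡ zero
  dep-agree-of-cumDep k cum≡ (suc s) =
    +-cancelˡ-≡ (A.cumDep k s) _ _ (trans (cum≡ (suc s)) (cong (_+ B.dep k (suc s)) (sym (cum≡ s))))

  cumDep-agree : ∀ k → (∀ s → A.dep k s ≡ B.dep k s) → ∀ s → A.cumDep k s ≡ B.cumDep k s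
  cumDep-agree k dep≡ zero    = dep≡ zero
  cumDep-agree k dep≡ (suc s) = cong₂ _+_ (cumDep-agree k dep≡ s) (dep≡ (suc s))

  cumDep-agree-everywhere : (∀ k → c k ≡ c′ k) → ∀ k s → A.cumDep k s ≡ B.cumDep k s
  cumDep-agree-everywhere c≗c′ k =
    cumDep-agree k (dep-agree k (c≗c′ (suc k)) (arr-agree-upTo k (λ k′ _ → c≗c′ (suc k′))))

-- In the paper's notation j = i + 1: the capacity of e_j, leaving x_i, is lowered
-- from c_j to b = c_{j+1}.
module CapacityReduction (w c l c′ : ℕ → ℕ) (i : ℕ)
  (c′ᵢ₊₁≡cᵢ₊₂ : c′ (suc i) ≡ c (suc (suc i)))
  (cᵢ₊₂≤cᵢ₊₁ : c (suc (suc i)) ≤ c (suc i))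
  (c′≗c : ∀ k → k ≢ suc i → c′ k ≡ c k) where

  open Agreement w c l w c′ l (λ _ → refl) (λ _ → refl)

  b j : ℕ
  b = c (suc (suc i))
  j = suc i

  inflowᵢ-agree : ∀ s → A.inflow i s ≡ B.inflow i s
  inflowᵢ-agree s = cong (w i +_) (sumTo-cong (arr-agree-upTo i c≡c′) s)
    where
    c≡c′ : ∀ k → k < i → c (suc k) ≡ c′ (suc k)
    c≡c′ k k<i = sym (c′≗c (suc k) (λ e → <⇒≢ k<i (suc-injective e)))

  depBeforeᵢ-lags : ∀ s → B.depBefore i s ≤ A.depBefore i s
  cumDepᵢ-lags : ∀ s → B.cumDep i s ≤ A.cumDep i s
  depBeforeᵢ-lags zero    = z≤n
  depBeforeᵢ-lags (suc s) = cumDepᵢ-lags s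
  cumDepᵢ-lags s = subst₂ _≤_ (sym (B.cumDep-recurrence i s)) (sym (A.cumDep-recurrence i s))
    (⊓-mono-≤ (+-mono-≤ (depBeforeᵢ-lags s) (≤-trans (≤-reflexive c′ᵢ₊₁≡cᵢ₊₂) cᵢ₊₂≤cᵢ₊₁))
              (≤-reflexive (sym (inflowᵢ-agree s))))

  lagging⇒full-wave : ∀ t → B.cumDep i t < A.cumDep i t → B.dep i t ≡ b
  lagging⇒full-wave t lag with ⊓-sel (B.depBefore i t + c′ (suc i)) (B.inflow i t)
  ... | inj₁ capped = trans
    (+-cancelˡ-≡ (B.depBefore i t) _ _
      (trans (sym (B.cumDep≡depBefore+dep i t)) (trans (B.cumDep-recurrence i t) capped)))
    c′ᵢ₊₁≡cᵢ₊₂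
  ... | inj₂ drained = contradiction
    (≤-trans (A.cumDep≤inflow i t)
      (≤-reflexive (trans (inflowᵢ-agree t) (sym (trans (B.cumDep-recurrence i t) drained)))))
    (<⇒≱ lag)

  inflowⱼ-agree-or-full-wave : ∀ s → A.inflow j s ≡ B.inflow j s
                             ⊎ (B.arr j s ≡ b × B.inflow j s ≤ A.inflow j s)
  inflowⱼ-agree-or-full-wave s rewrite A.inflow-suc i s | B.inflow-suc i s with l j ≤? s
  ... | no L≰s = inj₁ (cong (w j +_) (trans (delay-≰ (A.cumDep i) L≰s) (sym (delay-≰ (B.cumDep i) L≰s))))
  ... | yes L≤s
    rewrite delay-≤ (A.cumDep i) L≤s | delay-≤ (B.cumDep i) L≤s | delay-≤ (B.dep i) L≤s
    with m≤n⇒m<n∨m≡n (cumDepᵢ-lags (s ∸ l j))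
  ... | inj₂ same = inj₁ (cong (w j +_) (sym same))
  ... | inj₁ lag  = inj₂ (lagging⇒full-wave (s ∸ l j) lag , +-monoʳ-≤ (w j) (<⇒≤ lag))

  capped-inflowⱼ-agree : ∀ s → (B.depBefore j s + b) ⊓ A.inflow j s ≡ (B.depBefore j s + b) ⊓ B.inflow j s
  capped-inflowⱼ-agree s with inflowⱼ-agree-or-full-wave s
  ... | inj₁ same = cong ((B.depBefore j s + b) ⊓_) same
  ... | inj₂ (arr≡b , B≤A) = trans (m≤n⇒m⊓n≡m (≤-trans fits B≤A)) (sym (m≤n⇒m⊓n≡m fits))
    where
    fits : B.depBefore j s + b ≤ B.inflow j s
    fits = subst (λ a → B.depBefore j s + a ≤ B.inflow j s) arr≡b (B.depBefore+arr≤inflow j s)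

  depBeforeⱼ-agree : ∀ s → A.depBefore j s ≡ B.depBefore j s
  cumDepⱼ-agree : ∀ s → A.cumDep j s ≡ B.cumDep j s
  depBeforeⱼ-agree zero    = refl
  depBeforeⱼ-agree (suc s) = cumDepⱼ-agree s
  cumDepⱼ-agree s = begin
    A.cumDep j s                                  ≡⟨ A.cumDep-recurrence j s ⟩
    (A.depBefore j s + b) ⊓ A.inflow j s          ≡⟨ cong (λ x → (x + b) ⊓ A.inflow j s) (depBeforeⱼ-agree s) ⟩
    (B.depBefore j s + b) ⊓ A.inflow j s          ≡⟨ capped-inflowⱼ-agree s ⟩
    (B.depBefore j s + b) ⊓ B.inflow j s          ≡⟨ cong (λ x → (B.depBefore j s + x) ⊓ B.inflow j s) c′ⱼ₊₁≡b ⟨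
    (B.depBefore j s + c′ (suc j)) ⊓ B.inflow j s ≡⟨ B.cumDep-recurrence j s ⟨
    B.cumDep j s                                  ∎
    where
    open ≡-Reasoning
    c′ⱼ₊₁≡b : c′ (suc j) ≡ b
    c′ⱼ₊₁≡b = c′≗c (suc j) (λ e → <⇒≢ ≤-refl (sym e))

  cumDep-agree-from-j : ∀ k → j ≤ k → ∀ s → A.cumDep k s ≡ B.cumDep k s
  cumDep-agree-from-j k j≤k = cumDep-agree k
    (dep-agree-beyond j (dep-agree-of-cumDep j cumDepⱼ-agree) c≡c′ k j≤k)
    where
    c≡c′ : ∀ k → j < k → c (suc k) ≡ c′ (suc k)
    c≡c′ k j<k = sym (c′≗c (suc k) (λ e → <⇒≢ (m<n⇒m<1+n j<k) (sym e)))

lemma1 : (P P′ : DynPath) (m : ℕ) (d : ℚ)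
         → m < n P → 0ℚ <ℚ d → d ≤ℚ toℚ (len P (suc m))
         → (j : ℕ) → 1 ≤ j → j ≤ m → cap P (suc j) < cap P j
         → n P′ ≡ n P
         → (∀ i → len P′ i ≡ len P i)
         → (∀ i → weight P′ i ≡ weight P i)
         → cap P′ j ≡ cap P (suc j)
         → (∀ i → i ≢ j → cap P′ i ≡ cap P i)
         → Σ ℚ (λ θ → IsΘL P m d θ × IsΘL P′ m d θ)
lemma1 _ _ _ _ _ _ _ zero () _ _ _ _ _ _ _
lemma1 P P′ m d m<n _ _ (suc i) _ j≤m cⱼ₊₁<cⱼ _ l′≗l w′≗w c′ⱼ≡cⱼ₊₁ c′≗c =
  let θ , isΘ = ΘL-exists P m d m<n
  in θ , isΘ , completionTime-cong (sumTo-cong (λ k → sym (w′≗w k)) m) cumDep≡ isΘ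
  where
  open CapacityReduction (weight P) (cap P) (len P) (cap P′) i c′ⱼ≡cⱼ₊₁ (<⇒≤ cⱼ₊₁<cⱼ) c′≗c
    using (cumDep-agree-from-j)
  open Agreement (weight P) (cap P′) (len P) (weight P′) (cap P′) (len P′)
    (λ k → sym (w′≗w k)) (λ k → sym (l′≗l k))
    using (cumDep-agree-everywhere)

  cumDep≡ : ∀ s → Dynamics.cumDep (weight P) (cap P) (len P) m s
                ≡ Dynamics.cumDep (weight P′) (cap P′) (len P′) m s
  cumDep≡ s = trans (cumDep-agree-from-j m j≤m s) (cumDep-agree-everywhere (λ _ → refl) m s)
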